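{- Let $k\geq 4$ be an integer. If $G$ is a nontrivial connected graph with $k\ge \Delta(G)\ge 1$, then \[ i_{[kR]}(G)\ge \frac{|V(G)|(k+1)}{\Delta(G)+1}.\] Moreover, if $i_{[kR]}(G)=\frac{|V(G)|(k+1)}{\Delta(G)+1}$, then $i_{[kR]}(G)=(k+1)\,i(G)$.
   Context: All graphs are finite and simple; nontrivial means at least two vertices; $\Delta(G)$ is the maximum degree. $i(G)$ is the minimum size of an independent dominating set of $G$. For $f\colon V(G)\to\mathbb{Z}_{\ge 0}$ and $S\subseteq V(G)$, $f(S)=\sum_{v\in S}f(v)$, and $AN(v)=\{w\in N(v): f(w)\ge 1\}$. A $[k]$-Roman dominating function of $G$ is a function $f\colon V(G)\to\{0,1,\ldots,k+1\}$ such that $f(N[v])\ge k+|AN(v)|$ for every vertex $v$ with $f(v)<k$; its weight is $f(V(G))$. $i_{[kR]}(G)$ is the minimum weight of such a function whose set of vertices with positive label is independent. (The paper calls a graph with $i_{[kR]}(G)=(k+1)i(G)$ independent $[k]$-Roman.) -}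

module Defs where

open import Data.Nat using (ℕ; zero; suc; _+_; _*_; _≤_; _<_; _⊔_)
open import Data.Fin using (Fin)
open import Data.List using (List; map; foldr; allFin)
open import Data.Nat.ListAction using (sum)
open import Data.Bool using (Bool; true; false; if_then_else_; _∧_)
open import Data.Product using (Σ; _×_; ∃)
open import Data.Sum using (_⊎_)
open import Relation.Binary.PropositionalEquality using (_≡_)
open import Relation.Nullary using (¬_)
open import Relation.Nullary.Decidable using (⌊_⌋)
import Data.Nat as ℕ

record Graph (n : ℕ) : Set where
  field
    adj    : Fin n → Fin n → Bool
    sym    : ∀ u v → adj u v ≡ adj v u
    irrefl : ∀ v → adj v v ≡ false
open Graph public

Σv : {n : ℕ} → (Fin n → ℕ) → ℕ
Σv {n} g = sum (map g (allFin n))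

degree : {n : ℕ} → Graph n → Fin n → ℕ
degree G v = Σv (λ w → if adj G v w then 1 else 0)

-- maximum degree Δ(G) (0 for the empty graph)
maxDegree : {n : ℕ} → Graph n → ℕ
maxDegree {n} G = foldr _⊔_ 0 (map (degree G) (allFin n))

data Reach {n : ℕ} (G : Graph n) : Fin n → Fin n → Set where
  here : ∀ {v} → Reach G v v
  step : ∀ {u w v} → adj G u w ≡ true → Reach G w v → Reach G u v

Connected : {n : ℕ} → Graph n → Set
Connected G = ∀ u v → Reach G u v

IndependentSet : {n : ℕ} → Graph n → (Fin n → Bool) → Set
IndependentSet G S = ∀ u v → adj G u v ≡ true → S u ≡ true → S v ≡ false

Dominating : {n : ℕ} → Graph n → (Fin n → Bool) → Set
Dominating G S = ∀ v → S v ≡ true ⊎ ∃ (λ u → adj G v u ≡ true × S u ≡ true)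

IsIDS : {n : ℕ} → Graph n → (Fin n → Bool) → Set
IsIDS G S = IndependentSet G S × Dominating G S

card : {n : ℕ} → (Fin n → Bool) → ℕ
card S = Σv (λ v → if S v then 1 else 0)

IsIndepDomNumber : {n : ℕ} → Graph n → ℕ → Set
IsIndepDomNumber G i =
  (∃ λ S → IsIDS G S × card S ≡ i) × (∀ S → IsIDS G S → i ≤ card S)

weight : {n : ℕ} → (Fin n → ℕ) → ℕ
weight f = Σv f

fN : {n : ℕ} → Graph n → (Fin n → ℕ) → Fin n → ℕ
fN G f v = f v + Σv (λ w → if adj G v w then f w else 0)

activeNbrs : {n : ℕ} → Graph n → (Fin n → ℕ) → Fin n → ℕ
activeNbrs G f v = Σv (λ w → if adj G v w ∧ ⌊ 1 ℕ.≤? f w ⌋ then 1 else 0)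

IsKRDF : {n : ℕ} → ℕ → Graph n → (Fin n → ℕ) → Set
IsKRDF k G f =
  (∀ v → f v ≤ suc k) ×
  (∀ v → f v < k → k + activeNbrs G f v ≤ fN G f v)

PositiveIndependent : {n : ℕ} → Graph n → (Fin n → ℕ) → Set
PositiveIndependent G f = ∀ u v → adj G u v ≡ true → 1 ≤ f u → ¬ (1 ≤ f v)

IsIKRDF : {n : ℕ} → ℕ → Graph n → (Fin n → ℕ) → Set
IsIKRDF k G f = IsKRDF k G f × PositiveIndependent G f

IsIKRNumber : {n : ℕ} → ℕ → Graph n → ℕ → Set
IsIKRNumber k G w =
  (∃ λ f → IsIKRDF k G f × weight f ≡ w) × (∀ f → IsIKRDF k G f → w ≤ weight f)

-- Discharging. Let f be an independent [k]-Roman dominating function and let D ≥ 1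
-- bound the degrees. Positive labels are k or k + 1 and have only 0-labelled
-- neighbours; a 0-labelled vertex with m positive neighbours of total label S has
-- k + m ≤ S ≤ (k + 1) m. Give every vertex v the charge D (D + 1) f(v) and let every
-- positive vertex pass (D + 1) f(v) − (k + 1) to each neighbour. Afterwards every
-- vertex holds at least D (k + 1): a positive vertex by the rearrangement inequality,
-- a 0-labelled one because (D + 1) S − (k + 1) m ≥ D (k + 1) when k ≥ 4. Summing gives
-- n (k + 1) ≤ (D + 1) w(f).
-- A vertex labelled k makes some vertex strict: itself if its degree is below D,
-- otherwise any neighbour, where then S < (k + 1) m. Hence in the equality case all
-- positive labels are k + 1, so w = (k + 1) |P| ≥ (k + 1) i(G) for the independent
-- dominating set P of positive vertices; conversely k + 1 times the indicator of an
-- independent dominating set is an independent [k]-Roman dominating function.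

module Submission where

open import Defs
open import Data.Nat using (ℕ; zero; suc; _+_; _*_; _∸_; _≤_; _<_; z≤n; s≤s; z<s; >-nonZero)
open import Data.Nat.Properties
open import Data.Nat.Tactic.RingSolver using (solve-∀)
open import Data.Nat.ListAction using (sum)
open import Algebra.Properties.Semiring.Sum +-*-semiring
  using (∑-distrib-+; ∑-comm; *-distribˡ-sum; *-distribʳ-sum; sum-cong-≗; sum-replicate-zero)
  renaming (sum to ∑)
open import Data.Fin using (Fin; zero; suc)
open import Data.List using (map; allFin; tabulate)
open import Data.List.Properties using (map-tabulate; foldr-forcesᵇ)
open import Data.List.Relation.Unary.All as All using (All)
open import Data.List.Relation.Unary.All.Properties using (map⁻)
open import Data.List.Membership.Propositional.Properties using (∈-allFin)
open import Data.Bool using (Bool; true; false; if_then_else_; _∧_)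
open import Data.Product using (∃; _×_; _,_; proj₁; proj₂)
open import Data.Sum using (_⊎_; inj₁; inj₂)
open import Data.Empty using (⊥-elim)
open import Function using (_∘_; id)
open import Relation.Nullary using (¬_; yes; no)
open import Relation.Nullary.Decidable using (⌊_⌋)
open import Relation.Binary.PropositionalEquality as ≡
  using (_≡_; refl; trans; cong; cong₂; subst; subst₂; module ≡-Reasoning)

sum-tabulate : ∀ {n} (g : Fin n → ℕ) → sum (tabulate g) ≡ ∑ g
sum-tabulate {zero}  g = refl
sum-tabulate {suc n} g = cong (g zero +_) (sum-tabulate (g ∘ suc))

Σv≡∑ : ∀ {n} (g : Fin n → ℕ) → Σv g ≡ ∑ g
Σv≡∑ g = trans (cong sum (map-tabulate id g)) (sum-tabulate g)

∑-const : ∀ n c → ∑ {n} (λ _ → c) ≡ n * c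
∑-const zero    c = refl
∑-const (suc n) c = cong (c +_) (∑-const n c)

∑-mono-≤ : ∀ {n} {g h : Fin n → ℕ} → (∀ i → g i ≤ h i) → ∑ g ≤ ∑ h
∑-mono-≤ {zero}  g≤h = z≤n
∑-mono-≤ {suc n} g≤h = +-mono-≤ (g≤h zero) (∑-mono-≤ (g≤h ∘ suc))

∑-mono-< : ∀ {n} {g h : Fin n → ℕ} → (∀ i → g i ≤ h i) → ∀ j → g j < h j → ∑ g < ∑ h
∑-mono-< g≤h zero    gj<hj = +-mono-<-≤ gj<hj (∑-mono-≤ (g≤h ∘ suc))
∑-mono-< g≤h (suc j) gj<hj = +-mono-≤-< (g≤h zero) (∑-mono-< (g≤h ∘ suc) j gj<hj)

term≤∑ : ∀ {n} (g : Fin n → ℕ) i → g i ≤ ∑ g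
term≤∑ g zero    = m≤m+n _ _
term≤∑ g (suc i) = ≤-trans (term≤∑ (g ∘ suc) i) (m≤n+m _ (g zero))

∑-positive : ∀ {n} (g : Fin n → ℕ) → 0 < ∑ g → ∃ λ i → 0 < g i
∑-positive {suc n} g 0<∑ with g zero in g₀≡
... | suc _ = zero , subst (0 <_) (≡.sym g₀≡) z<s
... | zero  = let i , 0<gi = ∑-positive (g ∘ suc) 0<∑ in suc i , 0<gi

∑-cancel-≤ : ∀ {n} {a b c d : Fin n → ℕ} → ∑ c ≡ ∑ d →
             (∀ i → a i + c i ≤ b i + d i) → ∑ a ≤ ∑ b
∑-cancel-≤ {a = a} {b} {c} {d} ∑c≡∑d a+c≤b+d = +-cancelʳ-≤ (∑ c) (∑ a) (∑ b) (begin
  ∑ a + ∑ c                ≡⟨ ∑-distrib-+ a c ⟨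
  ∑ (λ i → a i + c i)      ≤⟨ ∑-mono-≤ a+c≤b+d ⟩
  ∑ (λ i → b i + d i)      ≡⟨ ∑-distrib-+ b d ⟩
  ∑ b + ∑ d                ≡⟨ cong (∑ b +_) ∑c≡∑d ⟨
  ∑ b + ∑ c                ∎)
  where open ≤-Reasoning

∑-cancel-< : ∀ {n} {a b c d : Fin n → ℕ} → ∑ c ≡ ∑ d →
             (∀ i → a i + c i ≤ b i + d i) → ∀ j → a j + c j < b j + d j → ∑ a < ∑ b
∑-cancel-< {a = a} {b} {c} {d} ∑c≡∑d a+c≤b+d j aj+cj<bj+dj = +-cancelʳ-< (∑ c) (∑ a) (∑ b) (begin-strict
  ∑ a + ∑ c                ≡⟨ ∑-distrib-+ a c ⟨
  ∑ (λ i → a i + c i)      <⟨ ∑-mono-< a+c≤b+d j aj+cj<bj+dj ⟩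
  ∑ (λ i → b i + d i)      ≡⟨ ∑-distrib-+ b d ⟩
  ∑ b + ∑ d                ≡⟨ cong (∑ b +_) ∑c≡∑d ⟨
  ∑ b + ∑ c                ∎)
  where open ≤-Reasoning

Σv-indicator : ∀ {n} {g : Fin n → ℕ} (S : Fin n → Bool) c →
               (∀ v → g v ≡ (if S v then c else 0)) → Σv g ≡ c * card S
Σv-indicator {g = g} S c g≡ = begin
  Σv g                                 ≡⟨ Σv≡∑ g ⟩
  ∑ g                                  ≡⟨ sum-cong-≗ (λ v → trans (g≡ v) (scaled (S v))) ⟩
  ∑ (λ v → c * (if S v then 1 else 0)) ≡⟨ *-distribˡ-sum c (λ v → if S v then 1 else 0) ⟨
  c * ∑ (λ v → if S v then 1 else 0)   ≡⟨ cong (c *_) (Σv≡∑ (λ v → if S v then 1 else 0)) ⟨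
  c * card S                           ∎
  where
  open ≡-Reasoning
  scaled : ∀ b → (if b then c else 0) ≡ c * (if b then 1 else 0)
  scaled true  = ≡.sym (*-identityʳ c)
  scaled false = ≡.sym (*-zeroʳ c)

sgn : ℕ → ℕ
sgn zero    = 0
sgn (suc _) = 1

zero⊎positive : ∀ t → t ≡ 0 ⊎ 1 ≤ t
zero⊎positive zero    = inj₁ refl
zero⊎positive (suc _) = inj₂ (s≤s z≤n)

sgn-positive : ∀ {t} → 1 ≤ t → sgn t ≡ 1
sgn-positive {suc _} _ = refl

sgn*≤ : ∀ {c t} → (1 ≤ t → c ≤ t) → sgn t * c ≤ t
sgn*≤ {t = zero}      _    = z≤n
sgn*≤ {c} {t = suc t} c≤t = subst (_≤ suc t) (≡.sym (+-identityʳ c)) (c≤t (s≤s z≤n))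

≤sgn* : ∀ {c t} → t ≤ c → t ≤ sgn t * c
≤sgn* {c} {zero}  _   = z≤n
≤sgn* {c} {suc t} t≤c = subst (suc t ≤_) (≡.sym (+-identityʳ c)) t≤c

support : ∀ {n} → (Fin n → ℕ) → Fin n → Bool
support f v = ⌊ 1 ≤? f v ⌋

1≤?-indicator≡sgn : ∀ t → (if ⌊ 1 ≤? t ⌋ then 1 else 0) ≡ sgn t
1≤?-indicator≡sgn zero    = refl
1≤?-indicator≡sgn (suc _) = refl

1≤⇒1≤?≡true : ∀ {t} → 1 ≤ t → ⌊ 1 ≤? t ⌋ ≡ true
1≤⇒1≤?≡true {suc _} _ = refl

1≤?≡true⇒1≤ : ∀ {t} → ⌊ 1 ≤? t ⌋ ≡ true → 1 ≤ t
1≤?≡true⇒1≤ {suc _} _ = s≤s z≤n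

module _ {n} (G : Graph n) where

  nbrSum : (Fin n → ℕ) → Fin n → ℕ
  nbrSum g v = ∑ (λ w → if adj G v w then g w else 0)

  degree≡nbrSum : ∀ v → degree G v ≡ nbrSum (λ _ → 1) v
  degree≡nbrSum v = Σv≡∑ (λ w → if adj G v w then 1 else 0)

  fN≡f+nbrSum : ∀ f v → fN G f v ≡ f v + nbrSum f v
  fN≡f+nbrSum f v = cong (f v +_) (Σv≡∑ (λ w → if adj G v w then f w else 0))

  activeNbrs≡nbrSum-sgn : ∀ f v → activeNbrs G f v ≡ nbrSum (sgn ∘ f) v
  activeNbrs≡nbrSum-sgn f v = trans (Σv≡∑ (λ w → if adj G v w ∧ ⌊ 1 ≤? f w ⌋ then 1 else 0)) (sum-cong-≗ active)
    where
    active : ∀ w → (if adj G v w ∧ ⌊ 1 ≤? f w ⌋ then 1 else 0) ≡ (if adj G v w then sgn (f w) else 0)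
    active w with adj G v w
    ... | true  = 1≤?-indicator≡sgn (f w)
    ... | false = refl

  nbrSum-mono-≤ : ∀ {g h} → (∀ w → g w ≤ h w) → ∀ v → nbrSum g v ≤ nbrSum h v
  nbrSum-mono-≤ g≤h v = ∑-mono-≤ pointwise
    where
    pointwise : ∀ w → (if adj G v w then _ else 0) ≤ (if adj G v w then _ else 0)
    pointwise w with adj G v w
    ... | true  = g≤h w
    ... | false = z≤n

  nbrSum-mono-< : ∀ {g h} → (∀ w → g w ≤ h w) → ∀ {v u} → adj G v u ≡ true → g u < h u →
                  nbrSum g v < nbrSum h v
  nbrSum-mono-< {g} {h} g≤h {v} {u} vu gu<hu = ∑-mono-< pointwise u at-u
    where
    pointwise : ∀ w → (if adj G v w then g w else 0) ≤ (if adj G v w then h w else 0)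
    pointwise w with adj G v w
    ... | true  = g≤h w
    ... | false = z≤n
    at-u : (if adj G v u then g u else 0) < (if adj G v u then h u else 0)
    at-u rewrite vu = gu<hu

  nbrSum-*ʳ : ∀ g c v → nbrSum (λ w → g w * c) v ≡ nbrSum g v * c
  nbrSum-*ʳ g c v = trans (sum-cong-≗ scaled) (≡.sym (*-distribʳ-sum c (λ w → if adj G v w then g w else 0)))
    where
    scaled : ∀ w → (if adj G v w then g w * c else 0) ≡ (if adj G v w then g w else 0) * c
    scaled w with adj G v w
    ... | true  = refl
    ... | false = refl

  nbrSum-≡0 : ∀ {g v} → (∀ w → adj G v w ≡ true → g w ≡ 0) → nbrSum g v ≡ 0
  nbrSum-≡0 {g} {v} nbrs≡0 = trans (sum-cong-≗ vanish) (sum-replicate-zero n)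
    where
    vanish : ∀ w → (if adj G v w then g w else 0) ≡ 0
    vanish w with adj G v w in vw
    ... | true  = nbrs≡0 w vw
    ... | false = refl

  term≤nbrSum : ∀ g {v w} → adj G v w ≡ true → g w ≤ nbrSum g v
  term≤nbrSum g {v} {w} vw = subst (λ b → (if b then g w else 0) ≤ nbrSum g v) vw
                               (term≤∑ (λ w → if adj G v w then g w else 0) w)

  nbrSum-positive : ∀ g v → 0 < nbrSum g v → ∃ λ w → adj G v w ≡ true × 0 < g w
  nbrSum-positive g v 0<sum with ∑-positive _ 0<sum
  ... | w , 0<term with adj G v w in vw
  ...   | true = w , vw , 0<term

  handshake : ∀ g → ∑ (nbrSum g) ≡ ∑ (λ w → g w * degree G w)
  handshake g = begin
    ∑ (λ v → ∑ (λ w → if adj G v w then g w else 0))  ≡⟨ ∑-comm (λ v w → if adj G v w then g w else 0) ⟩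
    ∑ (λ w → ∑ (λ v → if adj G v w then g w else 0))  ≡⟨ sum-cong-≗ (λ w → sum-cong-≗ (flip w)) ⟩
    ∑ (λ w → ∑ (λ v → g w * (if adj G w v then 1 else 0)))  ≡⟨ sum-cong-≗ (λ w → *-distribˡ-sum (g w) (λ v → if adj G w v then 1 else 0)) ⟨
    ∑ (λ w → g w * nbrSum (λ _ → 1) w)               ≡⟨ sum-cong-≗ (λ w → cong (g w *_) (degree≡nbrSum w)) ⟨
    ∑ (λ w → g w * degree G w)                       ∎
    where
    open ≡-Reasoning
    flip : ∀ w v → (if adj G v w then g w else 0) ≡ g w * (if adj G w v then 1 else 0)
    flip w v rewrite Graph.sym G v w with adj G w v
    ... | true  = ≡.sym (*-identityʳ (g w))
    ... | false = ≡.sym (*-zeroʳ (g w))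

  -- Along each edge v w, v sends τ⁺ v and takes τ⁻ v back; splitting the net
  -- transfer τ⁺ v − τ⁻ v in two avoids truncated subtraction.
  outflow inflow : (τ⁺ τ⁻ : Fin n → ℕ) → Fin n → ℕ
  outflow τ⁺ τ⁻ v = τ⁺ v * degree G v + nbrSum τ⁻ v
  inflow  τ⁺ τ⁻ v = nbrSum τ⁺ v + τ⁻ v * degree G v

  ∑outflow≡∑inflow : ∀ τ⁺ τ⁻ → ∑ (outflow τ⁺ τ⁻) ≡ ∑ (inflow τ⁺ τ⁻)
  ∑outflow≡∑inflow τ⁺ τ⁻ = begin
    ∑ (outflow τ⁺ τ⁻)                                          ≡⟨ ∑-distrib-+ _ (nbrSum τ⁻) ⟩
    ∑ (λ v → τ⁺ v * degree G v) + ∑ (nbrSum τ⁻)               ≡⟨ cong₂ _+_ (≡.sym (handshake τ⁺)) (handshake τ⁻) ⟩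
    ∑ (nbrSum τ⁺) + ∑ (λ v → τ⁻ v * degree G v)               ≡⟨ ∑-distrib-+ (nbrSum τ⁺) _ ⟨
    ∑ (inflow τ⁺ τ⁻)                                           ∎
    where open ≡-Reasoning

degree≤maxDegree : ∀ {n} (G : Graph n) v → degree G v ≤ maxDegree G
degree≤maxDegree {n} G v = All.lookup (map⁻ degrees≤) (∈-allFin v)
  where
  degrees≤ : All (_≤ maxDegree G) (map (degree G) (allFin n))
  degrees≤ = foldr-forcesᵇ (λ x y x⊔y≤Δ → m⊔n≤o⇒m≤o x y x⊔y≤Δ , m⊔n≤o⇒n≤o x y x⊔y≤Δ)
                           0 (map (degree G) (allFin n)) ≤-refl

rearrangement : ∀ {a b d D} → a ≤ b → d ≤ D → a * D + b * d + (b ∸ a) * (D ∸ d) ≡ b * D + a * d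
rearrangement {a} {d = d} a≤b d≤D with m≤n⇒∃[o]m+o≡n a≤b | m≤n⇒∃[o]m+o≡n d≤D
... | c , refl | e , refl rewrite m+n∸m≡n a c | m+n∸m≡n d e = identity a c d e
  where
  identity : ∀ a c d e → a * (d + e) + (a + c) * d + c * e ≡ (a + c) * (d + e) + a * d
  identity = solve-∀

rearrange-≤ : ∀ {a b d D} → a ≤ b → d ≤ D → a * D + b * d ≤ b * D + a * d
rearrange-≤ a≤b d≤D = ≤-trans (m≤m+n _ _) (≤-reflexive (rearrangement a≤b d≤D))

rearrange-< : ∀ {a b d D} → a < b → d < D → a * D + b * d < b * D + a * d
rearrange-< a<b d<D = ≤-trans (m<m+n _ (*-mono-< (m<n⇒0<n∸m a<b) (m<n⇒0<n∸m d<D)))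
                              (≤-reflexive (rearrangement (<⇒≤ a<b) (<⇒≤ d<D)))

suc<*suc : ∀ {k x D} → 2 ≤ k → k ≤ x → 1 ≤ D → suc k < x * suc D
suc<*suc {k} {x} {D} 2≤k k≤x 1≤D = begin-strict
  suc k      <⟨ +-monoˡ-≤ k 2≤k ⟩
  k + k      ≤⟨ +-mono-≤ k≤x (≤-trans k≤x (m≤m*n x D {{>-nonZero 1≤D}})) ⟩
  x + x * D  ≡⟨ *-suc x D ⟨
  x * suc D  ∎
  where open ≤-Reasoning

k+m≤m*suc-k : ∀ {k m} → 1 ≤ m → k + m ≤ m * suc k
k+m≤m*suc-k {k} {m} 1≤m = begin
  k + m      ≤⟨ +-monoˡ-≤ m (m≤n*m k m {{>-nonZero 1≤m}}) ⟩
  m * k + m  ≡⟨ +-comm (m * k) m ⟩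
  m + m * k  ≡⟨ *-suc m k ⟨
  m * suc k  ∎
  where open ≤-Reasoning

-- With D = 1 + p, k = 4 + q, m = 2 + r and S = m * k + a, the surplus is a
-- polynomial with nonnegative coefficients.
many-active : ∀ {D k m S} → 1 ≤ D → 4 ≤ k → 2 ≤ m → m * k ≤ S → suc k * D + m * suc k < S * suc D
many-active {suc p} {suc (suc (suc (suc q)))} {suc (suc r)} (s≤s z≤n) (s≤s (s≤s (s≤s (s≤s z≤n)))) (s≤s (s≤s z≤n)) mk≤S
  with m≤n⇒∃[o]m+o≡n mk≤S
... | a , refl = ≤-trans (m≤m+n _ _) (≤-reflexive (surplus p q r a))
  where
  surplus : ∀ p q r a →
    suc (suc (4 + q) * suc p + (2 + r) * suc (4 + q))
      + (3 * r + q + q * r + p * (3 + 4 * r + q + q * r) + a * (2 + p))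
    ≡ ((2 + r) * (4 + q) + a) * suc (suc p)
  surplus = solve-∀

no-active : ∀ {k S} → 4 ≤ k → k + 0 ≤ S → ¬ (S ≤ 0 * suc k)
no-active {k} 4≤k k≤S S≤0 = n≮0 (≤-trans 4≤k (≤-trans (m≤m+n k 0) (≤-trans k≤S S≤0)))

one-active : ∀ {k S} → k + 1 ≤ S → 1 * suc k ≤ S
one-active {k} {S} = subst (_≤ S) (trans (+-comm k 1) (≡.sym (+-identityʳ (suc k))))

-- D bounds the degree of a vertex labelled 0 whose m positive neighbours carry total label S.
zero-vertex-≤ : ∀ {D k m S} → 1 ≤ D → 4 ≤ k → k + m ≤ S → m * k ≤ S → S ≤ m * suc k →
                suc k * D + m * suc k ≤ S * suc D
zero-vertex-≤ {m = zero} _ 4≤k k≤S _ S≤0 = ⊥-elim (no-active 4≤k k≤S S≤0)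
zero-vertex-≤ {D} {k} {m = 1} _ _ k+1≤S _ S≤1*suc-k =
  ≤-reflexive (trans (identity k D) (cong (_* suc D) (≤-antisym (one-active k+1≤S) S≤1*suc-k)))
  where
  identity : ∀ k D → suc k * D + 1 * suc k ≡ 1 * suc k * suc D
  identity = solve-∀
zero-vertex-≤ {m = m@(suc (suc _))} 1≤D 4≤k _ mk≤S _ = <⇒≤ (many-active {m = m} 1≤D 4≤k (s≤s (s≤s z≤n)) mk≤S)

zero-vertex-< : ∀ {D k m S} → 1 ≤ D → 4 ≤ k → k + m ≤ S → m * k ≤ S → S < m * suc k →
                suc k * D + m * suc k < S * suc D
zero-vertex-< {m = zero} _ 4≤k k≤S _ S<0 = ⊥-elim (no-active 4≤k k≤S (<⇒≤ S<0))
zero-vertex-< {m = 1} _ _ k+1≤S _ S<1*suc-k = ⊥-elim (<⇒≱ S<1*suc-k (one-active k+1≤S))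
zero-vertex-< {m = m@(suc (suc _))} 1≤D 4≤k _ mk≤S _ = many-active {m = m} 1≤D 4≤k (s≤s (s≤s z≤n)) mk≤S

module IndependentRoman {n} (k : ℕ) (G : Graph n) (f : Fin n → ℕ) (f-ikrdf : IsIKRDF k G f) where

  bounded : ∀ v → f v ≤ suc k
  bounded = proj₁ (proj₁ f-ikrdf)

  condition : ∀ v → f v < k → k + nbrSum G (sgn ∘ f) v ≤ f v + nbrSum G f v
  condition v fv<k = subst₂ _≤_ (cong (k +_) (activeNbrs≡nbrSum-sgn G f v)) (fN≡f+nbrSum G f v) (proj₂ (proj₁ f-ikrdf) v fv<k)

  positive⇒nbr≡0 : ∀ {v w} → 1 ≤ f v → adj G v w ≡ true → f w ≡ 0
  positive⇒nbr≡0 {v} {w} 1≤fv vw with zero⊎positive (f w)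
  ... | inj₁ fw≡0 = fw≡0
  ... | inj₂ 1≤fw = ⊥-elim (proj₂ f-ikrdf v w vw 1≤fv 1≤fw)

  nbrSum-at-positive : ∀ {v} (h : ℕ → ℕ) → h 0 ≡ 0 → 1 ≤ f v → nbrSum G (h ∘ f) v ≡ 0
  nbrSum-at-positive h h0≡0 1≤fv = nbrSum-≡0 G (λ w vw → trans (cong h (positive⇒nbr≡0 1≤fv vw)) h0≡0)

  positive⇒≥k : ∀ {v} → 1 ≤ f v → k ≤ f v
  positive⇒≥k {v} 1≤fv with k ≤? f v
  ... | yes k≤fv = k≤fv
  ... | no  k≰fv = begin
    k                         ≤⟨ m≤m+n k _ ⟩
    k + nbrSum G (sgn ∘ f) v  ≤⟨ condition v (≰⇒> k≰fv) ⟩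
    f v + nbrSum G f v        ≡⟨ cong (f v +_) (nbrSum-at-positive id refl 1≤fv) ⟩
    f v + 0                   ≡⟨ +-identityʳ (f v) ⟩
    f v                       ∎
    where open ≤-Reasoning

  condition-at-zero : ∀ {v} → 1 ≤ k → f v ≡ 0 → k + nbrSum G (sgn ∘ f) v ≤ nbrSum G f v
  condition-at-zero {v} 1≤k fv≡0 =
    subst (λ t → k + nbrSum G (sgn ∘ f) v ≤ t + nbrSum G f v) fv≡0 (condition v (subst (_< k) (≡.sym fv≡0) 1≤k))

  active*k≤nbrSum : ∀ v → nbrSum G (sgn ∘ f) v * k ≤ nbrSum G f v
  active*k≤nbrSum v = subst (_≤ nbrSum G f v) (nbrSum-*ʳ G (sgn ∘ f) k v)
                            (nbrSum-mono-≤ G (λ w → sgn*≤ positive⇒≥k) v)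

  nbrSum≤active*suc : ∀ v → nbrSum G f v ≤ nbrSum G (sgn ∘ f) v * suc k
  nbrSum≤active*suc v = subst (nbrSum G f v ≤_) (nbrSum-*ʳ G (sgn ∘ f) (suc k) v)
                              (nbrSum-mono-≤ G (λ w → ≤sgn* (bounded w)) v)

  nbrSum<active*suc : ∀ {v u} → 1 ≤ k → adj G v u ≡ true → f u ≡ k →
                      nbrSum G f v < nbrSum G (sgn ∘ f) v * suc k
  nbrSum<active*suc {v} {u} 1≤k vu fu≡k = subst (nbrSum G f v <_) (nbrSum-*ʳ G (sgn ∘ f) (suc k) v)
    (nbrSum-mono-< G (λ w → ≤sgn* (bounded w)) vu
      (subst (λ t → t < sgn t * suc k) (≡.sym fu≡k) (subst (k <_) suc-k≡sgn-k*suc-k (n<1+n k))))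
    where
    suc-k≡sgn-k*suc-k : suc k ≡ sgn k * suc k
    suc-k≡sgn-k*suc-k = ≡.sym (trans (cong (_* suc k) (sgn-positive 1≤k)) (*-identityˡ (suc k)))

  support-isIDS : 1 ≤ k → IsIDS G (support f)
  support-isIDS 1≤k = independent , dominating
    where
    independent : IndependentSet G (support f)
    independent u v uv u∈S = cong (λ t → ⌊ 1 ≤? t ⌋) (positive⇒nbr≡0 (1≤?≡true⇒1≤ u∈S) uv)

    dominating : Dominating G (support f)
    dominating v with zero⊎positive (f v)
    ... | inj₂ 1≤fv = inj₁ (1≤⇒1≤?≡true 1≤fv)
    ... | inj₁ fv≡0 with nbrSum-positive G f v (≤-trans 1≤k (≤-trans (m≤m+n k _) (condition-at-zero 1≤k fv≡0)))
    ...   | u , vu , 1≤fu = inj₂ (u , vu , 1≤⇒1≤?≡true 1≤fu)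

  weight-without-k : (∀ v → ¬ f v ≡ k) → weight f ≡ suc k * card (support f)
  weight-without-k no-k = Σv-indicator (support f) (suc k) value
    where
    positive⇒suc-k : ∀ {v} → 1 ≤ f v → f v ≡ suc k
    positive⇒suc-k {v} 1≤fv = ≤-antisym (bounded v) (≤∧≢⇒< (positive⇒≥k 1≤fv) (λ k≡fv → no-k v (≡.sym k≡fv)))

    value : ∀ v → f v ≡ (if ⌊ 1 ≤? f v ⌋ then suc k else 0)
    value v with zero⊎positive (f v)
    ... | inj₁ fv≡0 rewrite fv≡0 = refl
    ... | inj₂ 1≤fv rewrite 1≤⇒1≤?≡true 1≤fv = positive⇒suc-k 1≤fv

indicator : ∀ {n} → ℕ → (Fin n → Bool) → Fin n → ℕ
indicator c T v = if T v then c else 0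

weight-indicator : ∀ {n} k (T : Fin n → Bool) → weight (indicator (suc k) T) ≡ suc k * card T
weight-indicator k T = Σv-indicator T (suc k) (λ _ → refl)

isIDS⇒isIKRDF : ∀ {n} k (G : Graph n) {T} → IsIDS G T → IsIKRDF k G (indicator (suc k) T)
isIDS⇒isIKRDF {n} k G {T} T-ids = (bounded , condition) , positive-independent
  where
  g : Fin n → ℕ
  g = indicator (suc k) T

  bounded : ∀ v → g v ≤ suc k
  bounded v with T v
  ... | true  = ≤-refl
  ... | false = z≤n

  g≡sgn*suc-k : ∀ w → g w ≡ sgn (g w) * suc k
  g≡sgn*suc-k w with T w
  ... | true  = ≡.sym (+-identityʳ (suc k))
  ... | false = refl

  nbrSum≡ : ∀ v → nbrSum G g v ≡ nbrSum G (sgn ∘ g) v * suc k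
  nbrSum≡ v = trans (sum-cong-≗ (λ w → cong (λ t → if adj G v w then t else 0) (g≡sgn*suc-k w)))
                    (nbrSum-*ʳ G (sgn ∘ g) (suc k) v)

  dominated : ∀ {v u} → adj G v u ≡ true → T u ≡ true → k + activeNbrs G g v ≤ nbrSum G g v
  dominated {v} {u} vu Tu = begin
    k + activeNbrs G g v             ≡⟨ cong (k +_) (activeNbrs≡nbrSum-sgn G g v) ⟩
    k + nbrSum G (sgn ∘ g) v         ≤⟨ k+m≤m*suc-k 1≤active ⟩
    nbrSum G (sgn ∘ g) v * suc k     ≡⟨ nbrSum≡ v ⟨
    nbrSum G g v                     ∎
    where
    open ≤-Reasoning
    1≤active : 1 ≤ nbrSum G (sgn ∘ g) v
    1≤active = subst (λ b → sgn (if b then suc k else 0) ≤ nbrSum G (sgn ∘ g) v) Tu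
                     (term≤nbrSum G (sgn ∘ g) vu)

  condition : ∀ v → g v < k → k + activeNbrs G g v ≤ fN G g v
  condition v gv<k with proj₂ T-ids v
  ... | inj₁ Tv = ⊥-elim (<-asym gv<k (subst (k <_) (cong (λ b → if b then suc k else 0) (≡.sym Tv)) (n<1+n k)))
  ... | inj₂ (u , vu , Tu) = begin
    k + activeNbrs G g v  ≤⟨ dominated vu Tu ⟩
    nbrSum G g v          ≤⟨ m≤n+m _ (g v) ⟩
    g v + nbrSum G g v    ≡⟨ fN≡f+nbrSum G g v ⟨
    fN G g v              ∎
    where open ≤-Reasoning

  positive-independent : PositiveIndependent G g
  positive-independent u v uv 1≤gu with T u in Tu
  positive-independent u v uv ()   | false
  positive-independent u v uv 1≤gu | true rewrite proj₁ T-ids u v uv Tu = λ ()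

module WeightBound {n k D} (G : Graph n) (f : Fin n → ℕ) (f-ikrdf : IsIKRDF k G f)
                   (4≤k : 4 ≤ k) (1≤D : 1 ≤ D) (degree≤D : ∀ v → degree G v ≤ D) where

  open IndependentRoman k G f f-ikrdf

  1≤k : 1 ≤ k
  1≤k = ≤-trans (s≤s z≤n) 4≤k

  -- Vertex v starts with τ⁺ v * D, needs suc k * D, and passes τ⁺ v − τ⁻ v to
  -- each neighbour.
  τ⁺ τ⁻ : Fin n → ℕ
  τ⁺ v = f v * suc D
  τ⁻ v = sgn (f v) * suc k

  debit credit : Fin n → ℕ
  debit  v = suc k * D + outflow G τ⁺ τ⁻ v
  credit v = τ⁺ v * D + inflow G τ⁺ τ⁻ v

  suc-k<τ⁺ : ∀ {v} → 1 ≤ f v → suc k < τ⁺ v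
  suc-k<τ⁺ 1≤fv = suc<*suc (≤-trans (s≤s (s≤s z≤n)) 4≤k) (positive⇒≥k 1≤fv) 1≤D

  debit-at-positive : ∀ {v} → 1 ≤ f v → debit v ≡ suc k * D + τ⁺ v * degree G v
  debit-at-positive {v} 1≤fv = begin
    suc k * D + (τ⁺ v * degree G v + nbrSum G τ⁻ v)  ≡⟨ cong (λ t → suc k * D + (τ⁺ v * degree G v + t))
                                                              (nbrSum-at-positive (λ t → sgn t * suc k) refl 1≤fv) ⟩
    suc k * D + (τ⁺ v * degree G v + 0)              ≡⟨ cong (suc k * D +_) (+-identityʳ _) ⟩
    suc k * D + τ⁺ v * degree G v                    ∎
    where open ≡-Reasoning

  credit-at-positive : ∀ {v} → 1 ≤ f v → credit v ≡ τ⁺ v * D + suc k * degree G v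
  credit-at-positive {v} 1≤fv = begin
    τ⁺ v * D + (nbrSum G τ⁺ v + τ⁻ v * degree G v)  ≡⟨ cong (λ t → τ⁺ v * D + (t + τ⁻ v * degree G v))
                                                             (nbrSum-at-positive (_* suc D) refl 1≤fv) ⟩
    τ⁺ v * D + τ⁻ v * degree G v                    ≡⟨ cong (λ t → τ⁺ v * D + t * degree G v) τ⁻≡suc-k ⟩
    τ⁺ v * D + suc k * degree G v                   ∎
    where
    open ≡-Reasoning
    τ⁻≡suc-k : τ⁻ v ≡ suc k
    τ⁻≡suc-k = trans (cong (_* suc k) (sgn-positive 1≤fv)) (*-identityˡ (suc k))

  debit-at-zero : ∀ {v} → f v ≡ 0 → debit v ≡ suc k * D + nbrSum G (sgn ∘ f) v * suc k
  debit-at-zero {v} fv≡0 = begin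
    debit v                                  ≡⟨ cong (λ t → suc k * D + (t * suc D * degree G v + nbrSum G τ⁻ v)) fv≡0 ⟩
    suc k * D + nbrSum G τ⁻ v                ≡⟨ cong (suc k * D +_) (nbrSum-*ʳ G (sgn ∘ f) (suc k) v) ⟩
    suc k * D + nbrSum G (sgn ∘ f) v * suc k ∎
    where open ≡-Reasoning

  credit-at-zero : ∀ {v} → f v ≡ 0 → credit v ≡ nbrSum G f v * suc D
  credit-at-zero {v} fv≡0 = begin
    credit v                  ≡⟨ cong (λ t → t * suc D * D + (nbrSum G τ⁺ v + sgn t * suc k * degree G v)) fv≡0 ⟩
    nbrSum G τ⁺ v + 0         ≡⟨ +-identityʳ _ ⟩
    nbrSum G τ⁺ v             ≡⟨ nbrSum-*ʳ G f (suc D) v ⟩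
    nbrSum G f v * suc D      ∎
    where open ≡-Reasoning

  balanced : ∀ v → debit v ≤ credit v
  balanced v with zero⊎positive (f v)
  ... | inj₁ fv≡0 = begin
    debit v                                   ≡⟨ debit-at-zero fv≡0 ⟩
    suc k * D + nbrSum G (sgn ∘ f) v * suc k  ≤⟨ zero-vertex-≤ 1≤D 4≤k (condition-at-zero 1≤k fv≡0)
                                                      (active*k≤nbrSum v) (nbrSum≤active*suc v) ⟩
    nbrSum G f v * suc D                      ≡⟨ credit-at-zero fv≡0 ⟨
    credit v                                  ∎
    where open ≤-Reasoning
  ... | inj₂ 1≤fv = begin
    debit v                         ≡⟨ debit-at-positive 1≤fv ⟩
    suc k * D + τ⁺ v * degree G v   ≤⟨ rearrange-≤ (<⇒≤ (suc-k<τ⁺ 1≤fv)) (degree≤D v) ⟩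
    τ⁺ v * D + suc k * degree G v   ≡⟨ credit-at-positive 1≤fv ⟨
    credit v                        ∎
    where open ≤-Reasoning

  strictly-balanced : ∀ {u} → f u ≡ k → ∃ λ v → debit v < credit v
  strictly-balanced {u} fu≡k with m≤n⇒m<n∨m≡n (degree≤D u)
  ... | inj₁ du<D = u , (begin-strict
    debit u                         ≡⟨ debit-at-positive 1≤fu ⟩
    suc k * D + τ⁺ u * degree G u   <⟨ rearrange-< (suc-k<τ⁺ 1≤fu) du<D ⟩
    τ⁺ u * D + suc k * degree G u   ≡⟨ credit-at-positive 1≤fu ⟨
    credit u                        ∎)
    where
    open ≤-Reasoning
    1≤fu : 1 ≤ f u
    1≤fu = subst (1 ≤_) (≡.sym fu≡k) 1≤k
  ... | inj₂ du≡D with nbrSum-positive G (λ _ → 1) u (subst (0 <_) (trans (≡.sym du≡D) (degree≡nbrSum G u)) 1≤D)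
  ...   | v , uv , _ = v , (begin-strict
    debit v                                   ≡⟨ debit-at-zero fv≡0 ⟩
    suc k * D + nbrSum G (sgn ∘ f) v * suc k  <⟨ zero-vertex-< 1≤D 4≤k (condition-at-zero 1≤k fv≡0)
                                                      (active*k≤nbrSum v) (nbrSum<active*suc 1≤k vu fu≡k) ⟩
    nbrSum G f v * suc D                      ≡⟨ credit-at-zero fv≡0 ⟨
    credit v                                  ∎)
    where
    open ≤-Reasoning
    fv≡0 : f v ≡ 0
    fv≡0 = positive⇒nbr≡0 (subst (1 ≤_) (≡.sym fu≡k) 1≤k) uv
    vu : adj G v u ≡ true
    vu = trans (Graph.sym G v u) uv

  total-demand : ∑ {n} (λ _ → suc k * D) ≡ n * suc k * D
  total-demand = trans (∑-const n (suc k * D)) (≡.sym (*-assoc n (suc k) D))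

  total-supply : ∑ (λ v → τ⁺ v * D) ≡ weight f * suc D * D
  total-supply = begin
    ∑ (λ v → τ⁺ v * D)        ≡⟨ *-distribʳ-sum D τ⁺ ⟨
    ∑ τ⁺ * D                  ≡⟨ cong (_* D) (*-distribʳ-sum (suc D) f) ⟨
    ∑ f * suc D * D           ≡⟨ cong (λ t → t * suc D * D) (Σv≡∑ f) ⟨
    weight f * suc D * D      ∎
    where open ≡-Reasoning

  weight-bound : n * suc k ≤ weight f * suc D
  weight-bound = *-cancelʳ-≤ (n * suc k) (weight f * suc D) D {{>-nonZero 1≤D}}
    (subst₂ _≤_ total-demand total-supply
      (∑-cancel-≤ {a = λ _ → suc k * D} {b = λ v → τ⁺ v * D} (∑outflow≡∑inflow G τ⁺ τ⁻) balanced))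

  weight-bound-< : ∀ {u} → f u ≡ k → n * suc k < weight f * suc D
  weight-bound-< fu≡k with strictly-balanced fu≡k
  ... | v , debit<credit = *-cancelʳ-< D (n * suc k) (weight f * suc D)
    (subst₂ _<_ total-demand total-supply
      (∑-cancel-< {a = λ _ → suc k * D} {b = λ v → τ⁺ v * D} (∑outflow≡∑inflow G τ⁺ τ⁻) balanced v debit<credit))

theorem3p5 : (k : ℕ) → 4 ≤ k → (n : ℕ) → 2 ≤ n → (G : Graph n) →
    Connected G → 1 ≤ maxDegree G → maxDegree G ≤ k →
    (w : ℕ) → IsIKRNumber k G w →
    (n * (k + 1) ≤ w * (maxDegree G + 1))
    × (w * (maxDegree G + 1) ≡ n * (k + 1) →
       (i : ℕ) → IsIndepDomNumber G i → w ≡ (k + 1) * i)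
theorem3p5 k 4≤k n _ G _ 1≤Δ _ _ ((f , f-ikrdf , refl) , minimal)
  rewrite +-comm k 1 | +-comm (maxDegree G) 1 = weight-bound , equality-case
  where
  open IndependentRoman k G f f-ikrdf
  open WeightBound G f f-ikrdf 4≤k 1≤Δ (degree≤maxDegree G)

  equality-case : weight f * suc (maxDegree G) ≡ n * suc k →
                  ∀ i → IsIndepDomNumber G i → weight f ≡ suc k * i
  equality-case tight _ ((T , T-ids , refl) , i-minimal) = ≤-antisym upper lower
    where
    no-k : ∀ v → ¬ f v ≡ k
    no-k v fv≡k = <-irrefl (≡.sym tight) (weight-bound-< fv≡k)

    upper : weight f ≤ suc k * card T
    upper = subst (weight f ≤_) (weight-indicator k T) (minimal _ (isIDS⇒isIKRDF k G T-ids))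

    lower : suc k * card T ≤ weight f
    lower = subst (suc k * card T ≤_) (≡.sym (weight-without-k no-k))
                  (*-monoʳ-≤ (suc k) (i-minimal _ (support-isIDS 1≤k)))
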